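{- For every finite set $\Gamma$ of formulas, finite multiset $\Delta$ of formulas and formula $A$: if $\Gamma;\Delta\vdash A$ is derivable, then $(\cdot;A)\preceq_s(\Gamma;\Delta)$, where $(\cdot;A)$ is the state with empty unrestricted part and linear part consisting of the single formula $A$.
   Context: Formulas: $A,B,C ::= a \mid \mathbf{1} \mid A\otimes B \mid \top \mid A \,\&\, B \mid a \multimap B \mid\ !A$, with $a$ ranging over atomic formulas. Contexts $\Gamma,\Delta$ are finite multisets of formulas; "$\Delta_1,\Delta_2$" is multiset union, "$\cdot$" the empty context. Sequents $\Gamma;\Delta\vdash A$ are derivable by the rules: (init) $\Gamma;a\vdash a$. (clone) from $\Gamma,A;\Delta,A\vdash C$ infer $\Gamma,A;\Delta\vdash C$. ($\otimes$R) from $\Gamma;\Delta_1\vdash A$ and $\Gamma;\Delta_2\vdash B$ infer $\Gamma;\Delta_1,\Delta_2\vdash A\otimes B$. ($\otimes$L) from $\Gamma;\Delta,A,B\vdash C$ infer $\Gamma;\Delta,A\otimes B\vdash C$. ($\mathbf 1$R) $\Gamma;\cdot\vdash\mathbf 1$. ($\mathbf 1$L) from $\Gamma;\Delta\vdash C$ infer $\Gamma;\Delta,\mathbf 1\vdash C$. ($\&$R) from $\Gamma;\Delta\vdash A$ and $\Gamma;\Delta\vdash B$ infer $\Gamma;\Delta\vdash A\&B$. ($\&$L$_i$, $i=1,2$) from $\Gamma;\Delta,A_i\vdash C$ infer $\Gamma;\Delta,A_1\&A_2\vdash C$. ($\top$R) $\Gamma;\Delta\vdash\top$ (no left rule for $\top$).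 ($\multimap$R) from $\Gamma;\Delta,a\vdash B$ infer $\Gamma;\Delta\vdash a\multimap B$. ($\multimap$L) from $\Gamma;\Delta_1\vdash a$ and $\Gamma;\Delta_2,B\vdash C$ infer $\Gamma;\Delta_1,\Delta_2,a\multimap B\vdash C$. (!R) from $\Gamma;\cdot\vdash A$ infer $\Gamma;\cdot\vdash\,!A$. (!L) from $\Gamma,A;\Delta\vdash C$ infer $\Gamma;\Delta,!A\vdash C$. States are pairs $(\Gamma;\Delta)$ modulo structural congruence $\equiv$: $\Delta$ is a multiset and $\Gamma$ a set ($(\Gamma,A,A;\Delta)\equiv(\Gamma,A;\Delta)$); congruent states are identified. Composition: $((\Gamma_1;\Delta_1),(\Gamma_2;\Delta_2)) := (\Gamma_1,\Gamma_2;\Delta_1,\Delta_2)$. Labelled transitions with labels $\tau$, $!a$, $?a$ ($a$ atomic) are generated by: $(\Gamma;\Delta,a)\xrightarrow{!a}(\Gamma;\Delta)$; $(\Gamma;\Delta,a\multimap B)\xrightarrow{?a}(\Gamma;\Delta,B)$; if $S_1\xrightarrow{!a}S_1'$ and $S_2\xrightarrow{?a}S_2'$ then $(S_1,S_2)\xrightarrow{\tau}(S_1',S_2')$; $(\Gamma;\Delta,A\otimes B)\xrightarrow{\tau}(\Gamma;\Delta,A,B)$; $(\Gamma;\Delta,\mathbf 1)\xrightarrow{\tau}(\Gamma;\Delta)$; $(\Gamma;\Delta,A_1\&A_2)\xrightarrow{\tau}(\Gamma;\Delta,A_i)$; $(\Gamma;\Delta,!A)\xrightarrow{\tau}(\Gamma,A;\Delta)$;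 $(\Gamma,A;\Delta)\xrightarrow{\tau}(\Gamma,A;\Delta,A)$ (no rule for $\top$). $\alpha$ ranges over $\tau$ and $!a$. $\overset{\tau}{\Longrightarrow}$ is the reflexive transitive closure of $\xrightarrow{\tau}$; for $\beta\ne\tau$, $\overset{\beta}{\Longrightarrow}$ is $\overset{\tau}{\Longrightarrow}\xrightarrow{\beta}\overset{\tau}{\Longrightarrow}$. A relation $\mathcal R$ on states is a simulation if $(\Gamma_1;\Delta_1)\mathcal R(\Gamma_2;\Delta_2)$ implies: (1) if $(\Gamma_1;\Delta_1)\equiv(\Gamma_1';\cdot)$ then $(\Gamma_2;\Delta_2)\overset{\tau}{\Longrightarrow}(\Gamma_2';\cdot)$ with $(\Gamma_1';\cdot)\mathcal R(\Gamma_2';\cdot)$; (2) if $(\Gamma_1;\Delta_1)\equiv((\Gamma_1';\Delta_1'),(\Gamma_1'';\Delta_1''))$ then $(\Gamma_2;\Delta_2)\overset{\tau}{\Longrightarrow}((\Gamma_2';\Delta_2'),(\Gamma_2'';\Delta_2''))$ with $(\Gamma_1';\Delta_1')\mathcal R(\Gamma_2';\Delta_2')$ and $(\Gamma_1'';\Delta_1'')\mathcal R(\Gamma_2'';\Delta_2'')$; (3) if $(\Gamma_1;\Delta_1)\xrightarrow{\alpha}(\Gamma_1';\Delta_1')$ then $(\Gamma_2;\Delta_2)\overset{\alpha}{\Longrightarrow}(\Gamma_2';\Delta_2')$ with $(\Gamma_1';\Delta_1')\mathcal R(\Gamma_2';\Delta_2')$; (4) if $(\Gamma_1;\Delta_1)\xrightarrow{?a}(\Gamma_1';\Delta_1')$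 then $(\Gamma_2;\Delta_2,a)\overset{\tau}{\Longrightarrow}(\Gamma_2';\Delta_2')$ with $(\Gamma_1';\Delta_1')\mathcal R(\Gamma_2';\Delta_2')$. $S_1\preceq_s S_2$ iff some simulation relates $S_1$ to $S_2$. -}

module Defs where

open import Data.Nat using (ℕ)
open import Data.List using (List; []; _∷_; _++_)
open import Data.List.Membership.Propositional using (_∈_)
open import Data.List.Relation.Binary.Permutation.Propositional using (_↭_)
open import Data.List.Relation.Binary.BagAndSetEquality using (_∼[_]_; set)
open import Data.Product using (_×_; _,_; ∃; ∃-syntax)
open import Relation.Binary.Construct.Closure.ReflexiveTransitive using (Star)

Atom : Set
Atom = ℕ

infixr 6 _⊗_
infixr 5 _&_
infixr 4 _⊸_

data Formula : Set where
  atom : Atom → Formula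
  𝟏    : Formula
  _⊗_  : Formula → Formula → Formula
  ⊤'   : Formula
  _&_  : Formula → Formula → Formula
  _⊸_  : Atom → Formula → Formula
  !_   : Formula → Formula

-- Contexts represented by lists. The linear context Δ is a multiset
-- (lists up to permutation); the unrestricted context Γ is a set
-- (lists up to having the same elements).
Ctx : Set
Ctx = List Formula

-- Sequent calculus  Γ ; Δ ⊢ A
-- "Γ,A" with Γ a set: in (clone) the premise/conclusion context Γ,A is a set
-- containing A, i.e. A ∈ Γ; in (!L) Γ,A is Γ ∪ {A}, i.e. A ∷ Γ.
-- Δ is a multiset: rule `perm` identifies permuted linear contexts.

infix 3 _⨾_⊢_
data _⨾_⊢_ : Ctx → Ctx → Formula → Set where
  perm  : ∀ {Γ Δ Δ' C} → Γ ⨾ Δ ⊢ C → Δ ↭ Δ' → Γ ⨾ Δ' ⊢ C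
  init  : ∀ {Γ a} → Γ ⨾ atom a ∷ [] ⊢ atom a
  clone : ∀ {Γ Δ A C} → A ∈ Γ → Γ ⨾ A ∷ Δ ⊢ C → Γ ⨾ Δ ⊢ C
  ⊗R    : ∀ {Γ Δ₁ Δ₂ A B} → Γ ⨾ Δ₁ ⊢ A → Γ ⨾ Δ₂ ⊢ B → Γ ⨾ Δ₁ ++ Δ₂ ⊢ A ⊗ B
  ⊗L    : ∀ {Γ Δ A B C} → Γ ⨾ A ∷ B ∷ Δ ⊢ C → Γ ⨾ (A ⊗ B) ∷ Δ ⊢ C
  𝟏R    : ∀ {Γ} → Γ ⨾ [] ⊢ 𝟏
  𝟏L    : ∀ {Γ Δ C} → Γ ⨾ Δ ⊢ C → Γ ⨾ 𝟏 ∷ Δ ⊢ C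
  &R    : ∀ {Γ Δ A B} → Γ ⨾ Δ ⊢ A → Γ ⨾ Δ ⊢ B → Γ ⨾ Δ ⊢ A & B
  &L₁   : ∀ {Γ Δ A B C} → Γ ⨾ A ∷ Δ ⊢ C → Γ ⨾ (A & B) ∷ Δ ⊢ C
  &L₂   : ∀ {Γ Δ A B C} → Γ ⨾ B ∷ Δ ⊢ C → Γ ⨾ (A & B) ∷ Δ ⊢ C
  ⊤R    : ∀ {Γ Δ} → Γ ⨾ Δ ⊢ ⊤'
  ⊸R    : ∀ {Γ Δ a B} → Γ ⨾ atom a ∷ Δ ⊢ B → Γ ⨾ Δ ⊢ a ⊸ B
  ⊸L    : ∀ {Γ Δ₁ Δ₂ a B C} → Γ ⨾ Δ₁ ⊢ atom a → Γ ⨾ B ∷ Δ₂ ⊢ C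
        → Γ ⨾ (a ⊸ B) ∷ (Δ₁ ++ Δ₂) ⊢ C
  !R    : ∀ {Γ A} → Γ ⨾ [] ⊢ A → Γ ⨾ [] ⊢ ! A
  !L    : ∀ {Γ Δ A C} → A ∷ Γ ⨾ Δ ⊢ C → Γ ⨾ (! A) ∷ Δ ⊢ C

State : Set
State = Ctx × Ctx

infix 4 _≅_
_≅_ : State → State → Set
(Γ₁ , Δ₁) ≅ (Γ₂ , Δ₂) = (Γ₁ ∼[ set ] Γ₂) × (Δ₁ ↭ Δ₂)

_∥_ : State → State → State
(Γ₁ , Δ₁) ∥ (Γ₂ , Δ₂) = (Γ₁ ++ Γ₂ , Δ₁ ++ Δ₂)

data Label : Set where
  τ  : Label
  !ₗ : Atom → Label
  ?ₗ : Atom → Label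

-- Transitions on representatives
data _─[_]→₀_ : State → Label → State → Set where
  out  : ∀ {Γ Δ a} → (Γ , atom a ∷ Δ) ─[ !ₗ a ]→₀ (Γ , Δ)
  inp  : ∀ {Γ Δ a B} → (Γ , (a ⊸ B) ∷ Δ) ─[ ?ₗ a ]→₀ (Γ , B ∷ Δ)
  sync : ∀ {S₁ S₁' S₂ S₂' a} → S₁ ─[ !ₗ a ]→₀ S₁' → S₂ ─[ ?ₗ a ]→₀ S₂'
       → (S₁ ∥ S₂) ─[ τ ]→₀ (S₁' ∥ S₂')
  ⊗τ   : ∀ {Γ Δ A B} → (Γ , (A ⊗ B) ∷ Δ) ─[ τ ]→₀ (Γ , A ∷ B ∷ Δ)
  𝟏τ   : ∀ {Γ Δ} → (Γ , 𝟏 ∷ Δ) ─[ τ ]→₀ (Γ , Δ)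
  &τ₁  : ∀ {Γ Δ A B} → (Γ , (A & B) ∷ Δ) ─[ τ ]→₀ (Γ , A ∷ Δ)
  &τ₂  : ∀ {Γ Δ A B} → (Γ , (A & B) ∷ Δ) ─[ τ ]→₀ (Γ , B ∷ Δ)
  !τ   : ∀ {Γ Δ A} → (Γ , (! A) ∷ Δ) ─[ τ ]→₀ (A ∷ Γ , Δ)
  copy : ∀ {Γ Δ A} → A ∈ Γ → (Γ , Δ) ─[ τ ]→₀ (Γ , A ∷ Δ)

_─[_]→_ : State → Label → State → Set
S ─[ l ]→ S' = ∃[ T ] ∃[ T' ] (S ≅ T × T ─[ l ]→₀ T' × T' ≅ S')

_─τ→_ : State → State → Set
S ─τ→ S' = S ─[ τ ]→ S'

_⇒τ_ : State → State → Set
S ⇒τ S' = ∃[ T ] (Star _─τ→_ S T × T ≅ S')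

_⇒[_]_ : State → Label → State → Set
S ⇒[ β ] S' = ∃[ T ] ∃[ T' ] (S ⇒τ T × T ─[ β ]→ T' × T' ⇒τ S')

record IsSimulation (R : State → State → Set) : Set where
  field
    respects : ∀ {S₁ S₁' S₂ S₂'} → R S₁ S₂ → S₁ ≅ S₁' → S₂ ≅ S₂' → R S₁' S₂'
    empty    : ∀ {S₁ S₂ Γ₁'} → R S₁ S₂ → S₁ ≅ (Γ₁' , [])
             → ∃[ Γ₂' ] (S₂ ⇒τ (Γ₂' , []) × R (Γ₁' , []) (Γ₂' , []))
    split    : ∀ {S₁ S₂ P₁ Q₁} → R S₁ S₂ → S₁ ≅ (P₁ ∥ Q₁)
             → ∃[ P₂ ] ∃[ Q₂ ] (S₂ ⇒τ (P₂ ∥ Q₂) × R P₁ P₂ × R Q₁ Q₂)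
    stepτ    : ∀ {S₁ S₂ S₁'} → R S₁ S₂ → S₁ ─[ τ ]→ S₁'
             → ∃[ S₂' ] (S₂ ⇒τ S₂' × R S₁' S₂')
    step!    : ∀ {S₁ S₂ S₁' a} → R S₁ S₂ → S₁ ─[ !ₗ a ]→ S₁'
             → ∃[ S₂' ] (S₂ ⇒[ !ₗ a ] S₂' × R S₁' S₂')
    step?    : ∀ {Γ₁ Δ₁ Γ₂ Δ₂ S₁' a} → R (Γ₁ , Δ₁) (Γ₂ , Δ₂) → (Γ₁ , Δ₁) ─[ ?ₗ a ]→ S₁'
             → ∃[ S₂' ] ((Γ₂ , atom a ∷ Δ₂) ⇒τ S₂' × R S₁' S₂')

infix 4 _⪯ₛ_
_⪯ₛ_ : State → State → Set₁
S₁ ⪯ₛ S₂ = ∃[ R ] (IsSimulation R × R S₁ S₂)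

-- Read bottom-up, a derivation of Γ ; Δ ⊢ A is a computation of the state (Γ ; Δ):
-- every left rule (and clone) is a τ-step of that state, and ⊸L is a synchronisation
-- between the process proving the atom a and the consumer a ⊸ B.  So (Γ ; Δ) can run
-- until its derivation ends with a right rule, and a right rule is exactly what the
-- formula A needs in order to perform its own transition.  The simulation relates
-- (Γ₁ ; X₁ … Xₙ) to (Γ₂ ; Δ₂) when Δ₂ splits into D₁ … Dₙ with Γ₂ ; Dᵢ ⊢ Xᵢ and every
-- formula of Γ₁ is provable from Γ₂ alone; running the matching Dᵢ to its right rule
-- answers every challenge of the left state.
module Submission where

open import Defs
open import Data.List using ([]; _∷_; _++_; [_])
import Data.List.Properties as List
open import Data.List.Membership.Propositional using (_∈_)
open import Data.List.Membership.Propositional.Properties using (∈-++⁺ˡ; ∈-++⁺ʳ)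
open import Data.List.Relation.Unary.Any using (here; there)
open import Data.List.Relation.Binary.Subset.Propositional using (_⊆_)
open import Data.List.Relation.Binary.Subset.Propositional.Properties
  using (⊆-refl; ⊆-trans; ∷⁺ʳ; xs⊆x∷xs)
open import Data.List.Relation.Binary.Permutation.Propositional
  using (_↭_; refl; prep; swap; trans; ↭-refl; ↭-sym; ↭-trans)
open import Data.List.Relation.Binary.Permutation.Propositional.Properties
  using (++⁺ˡ; ++⁺ʳ; shift; shifts; ++-assoc; ++-identityʳ)
open import Data.List.Relation.Binary.BagAndSetEquality
  using (set; [_]-Equality; ++-idempotent)
open import Data.Product using (_,_; _×_; ∃-syntax)
open import Function.Bundles using (Equivalence)
open import Relation.Binary.Bundles using (Setoid)
open import Relation.Binary.Construct.Closure.ReflexiveTransitive using (Star; ε; _◅_)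
open import Relation.Binary.PropositionalEquality using (_≡_; refl; sym)

private
  module SetEq = Setoid ([ set ]-Equality Formula)

weaken : ∀ {Γ Γ' Δ C} → Γ ⊆ Γ' → Γ ⨾ Δ ⊢ C → Γ' ⨾ Δ ⊢ C
weaken s (perm d p)  = perm (weaken s d) p
weaken s init        = init
weaken s (clone m d) = clone (s m) (weaken s d)
weaken s (⊗R d₁ d₂)  = ⊗R (weaken s d₁) (weaken s d₂)
weaken s (⊗L d)      = ⊗L (weaken s d)
weaken s 𝟏R          = 𝟏R
weaken s (𝟏L d)      = 𝟏L (weaken s d)
weaken s (&R d₁ d₂)  = &R (weaken s d₁) (weaken s d₂)
weaken s (&L₁ d)     = &L₁ (weaken s d)
weaken s (&L₂ d)     = &L₂ (weaken s d)
weaken s ⊤R          = ⊤R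
weaken s (⊸R d)      = ⊸R (weaken s d)
weaken s (⊸L d₁ d₂)  = ⊸L (weaken s d₁) (weaken s d₂)
weaken s (!R d)      = !R (weaken s d)
weaken s (!L d)      = !L (weaken (∷⁺ʳ _ s) d)

≅-refl : ∀ {S} → S ≅ S
≅-refl = SetEq.refl , ↭-refl

≅-sym : ∀ {S S'} → S ≅ S' → S' ≅ S
≅-sym (Γ≈ , Δ↭) = SetEq.sym Γ≈ , ↭-sym Δ↭

≅-trans : ∀ {S S' S''} → S ≅ S' → S' ≅ S'' → S ≅ S''
≅-trans (Γ≈ , Δ↭) (Γ≈' , Δ↭') = SetEq.trans Γ≈ Γ≈' , ↭-trans Δ↭ Δ↭'

≅-++-identityʳ : ∀ {G Δ} → (G ++ [] , Δ) ≅ (G , Δ)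
≅-++-identityʳ {G} = SetEq.reflexive (List.++-identityʳ G) , ↭-refl

≅-─[]→ : ∀ {S S' S'' l} → S ≅ S' → S' ─[ l ]→ S'' → S ─[ l ]→ S''
≅-─[]→ e (T , T' , S'≅T , t , T'≅S'') = T , T' , ≅-trans e S'≅T , t , T'≅S''

─[]→₀⇒─[]→ : ∀ {T T' l} → T ─[ l ]→₀ T' → T ─[ l ]→ T'
─[]→₀⇒─[]→ t = _ , _ , ≅-refl , t , ≅-refl

⇒τ-reflexive : ∀ {S S'} → S ≅ S' → S ⇒τ S'
⇒τ-reflexive {S} e = S , ε , e

≅-⇒τ : ∀ {S S' S''} → S ≅ S' → S' ⇒τ S'' → S ⇒τ S''
≅-⇒τ {S} e (T , ε , q)      = S , ε , ≅-trans e q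
≅-⇒τ e     (T , t ◅ ts , q) = T , ≅-─[]→ e t ◅ ts , q

─τ→-⇒τ : ∀ {S S' S''} → S ─τ→ S' → S' ⇒τ S'' → S ⇒τ S''
─τ→-⇒τ t (T , ts , q) = T , t ◅ ts , q

⇒τ-trans : ∀ {S S' S''} → S ⇒τ S' → S' ⇒τ S'' → S ⇒τ S''
⇒τ-trans (T , ts , q) r = go ts
  where
  go : ∀ {S} → Star _─τ→_ S T → S ⇒τ _
  go ε        = ≅-⇒τ q r
  go (t ◅ ts) = ─τ→-⇒τ t (go ts)

data HeadStep : State → State → Set where
  ⊗-step    : ∀ {Γ Δ A B} → HeadStep (Γ , (A ⊗ B) ∷ Δ) (Γ , A ∷ B ∷ Δ)
  𝟏-step    : ∀ {Γ Δ} → HeadStep (Γ , 𝟏 ∷ Δ) (Γ , Δ)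
  &₁-step   : ∀ {Γ Δ A B} → HeadStep (Γ , (A & B) ∷ Δ) (Γ , A ∷ Δ)
  &₂-step   : ∀ {Γ Δ A B} → HeadStep (Γ , (A & B) ∷ Δ) (Γ , B ∷ Δ)
  !-step    : ∀ {Γ Δ A} → HeadStep (Γ , (! A) ∷ Δ) (A ∷ Γ , Δ)
  copy-step : ∀ {Γ Δ A} → A ∈ Γ → HeadStep (Γ , Δ) (Γ , A ∷ Δ)
  sync-step : ∀ {Γ Δ a B} → HeadStep (Γ , atom a ∷ (a ⊸ B) ∷ Δ) (Γ , B ∷ Δ)

HeadStep⇒─τ→ : ∀ {S S'} → HeadStep S S' → S ─τ→ S'
HeadStep⇒─τ→ ⊗-step        = ─[]→₀⇒─[]→ ⊗τ
HeadStep⇒─τ→ 𝟏-step        = ─[]→₀⇒─[]→ 𝟏τ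
HeadStep⇒─τ→ &₁-step       = ─[]→₀⇒─[]→ &τ₁
HeadStep⇒─τ→ &₂-step       = ─[]→₀⇒─[]→ &τ₂
HeadStep⇒─τ→ !-step        = ─[]→₀⇒─[]→ !τ
HeadStep⇒─τ→ (copy-step m) = ─[]→₀⇒─[]→ (copy m)
HeadStep⇒─τ→ (sync-step {Γ} {Δ} {a} {B}) =
  _ , _ , ≅-sym ≅-++-identityʳ ,
  sync {S₁ = Γ , [ atom a ]} {S₂ = [] , (a ⊸ B) ∷ Δ} out inp , ≅-++-identityʳ

─[τ]→₀⇒HeadStep : ∀ {T T'} → T ─[ τ ]→₀ T' → ∃[ U ] ∃[ U' ] (T ≅ U × HeadStep U U' × U' ≅ T')
─[τ]→₀⇒HeadStep (sync (out {Δ = Δₒ} {a}) (inp {Δ = Δᵢ} {B = B})) =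
  _ , _ , (SetEq.refl , prep (atom a) (shift (a ⊸ B) Δₒ Δᵢ)) , sync-step ,
  (SetEq.refl , ↭-sym (shift B Δₒ Δᵢ))
─[τ]→₀⇒HeadStep ⊗τ       = _ , _ , ≅-refl , ⊗-step , ≅-refl
─[τ]→₀⇒HeadStep 𝟏τ       = _ , _ , ≅-refl , 𝟏-step , ≅-refl
─[τ]→₀⇒HeadStep &τ₁      = _ , _ , ≅-refl , &₁-step , ≅-refl
─[τ]→₀⇒HeadStep &τ₂      = _ , _ , ≅-refl , &₂-step , ≅-refl
─[τ]→₀⇒HeadStep !τ       = _ , _ , ≅-refl , !-step , ≅-refl
─[τ]→₀⇒HeadStep (copy m) = _ , _ , ≅-refl , copy-step m , ≅-refl

data RightRule (G : Ctx) : Ctx → Formula → Set where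
  init : ∀ {a} → RightRule G [ atom a ] (atom a)
  ⊗R   : ∀ {D₁ D₂ A B} → G ⨾ D₁ ⊢ A → G ⨾ D₂ ⊢ B → RightRule G (D₁ ++ D₂) (A ⊗ B)
  𝟏R   : RightRule G [] 𝟏
  ⊤R   : ∀ {D} → RightRule G D ⊤'
  &R   : ∀ {D A B} → G ⨾ D ⊢ A → G ⨾ D ⊢ B → RightRule G D (A & B)
  ⊸R   : ∀ {D a B} → G ⨾ atom a ∷ D ⊢ B → RightRule G D (a ⊸ B)
  !R   : ∀ {A} → G ⨾ [] ⊢ A → RightRule G [] (! A)

-- E is a frame: resources that the run leaves untouched.
ReachesRightRule : Ctx → Ctx → Ctx → Formula → Set
ReachesRightRule G Δ E X =
  ∃[ G' ] ∃[ D ] ((G , Δ) ⇒τ (G' , D ++ E) × G ⊆ G' × RightRule G' D X)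

reachesRightRule-now : ∀ {G D E X} → RightRule G D X → ReachesRightRule G (D ++ E) E X
reachesRightRule-now {G} rule = G , _ , ⇒τ-reflexive ≅-refl , ⊆-refl , rule

reachesRightRule-⇒τ : ∀ {G Δ G' Δ' E X} → (G , Δ) ⇒τ (G' , Δ') → G ⊆ G'
  → ReachesRightRule G' Δ' E X → ReachesRightRule G Δ E X
reachesRightRule-⇒τ run G⊆G' (G'' , D , run' , G'⊆G'' , rule) =
  G'' , D , ⇒τ-trans run run' , ⊆-trans G⊆G' G'⊆G'' , rule

reachesRightRule-↭ : ∀ {G Δ Δ' E X} → Δ ↭ Δ' → ReachesRightRule G Δ' E X → ReachesRightRule G Δ E X
reachesRightRule-↭ p = reachesRightRule-⇒τ (⇒τ-reflexive (SetEq.refl , p)) ⊆-refl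

reachesRightRule-step : ∀ {G Δ G' Δ' E X} → HeadStep (G , Δ) (G' , Δ') → G ⊆ G'
  → ReachesRightRule G' Δ' E X → ReachesRightRule G Δ E X
reachesRightRule-step n = reachesRightRule-⇒τ (─τ→-⇒τ (HeadStep⇒─τ→ n) (⇒τ-reflexive ≅-refl))

⊢⇒reachesRightRule : ∀ {Γ G D X} → Γ ⨾ D ⊢ X → Γ ⊆ G → ∀ E → ReachesRightRule G (D ++ E) E X
⊢⇒reachesRightRule (perm d p) s E =
  reachesRightRule-↭ (++⁺ʳ E (↭-sym p)) (⊢⇒reachesRightRule d s E)
⊢⇒reachesRightRule (clone m d) s E =
  reachesRightRule-step (copy-step (s m)) ⊆-refl (⊢⇒reachesRightRule d s E)
⊢⇒reachesRightRule (⊗L d) s E = reachesRightRule-step ⊗-step ⊆-refl (⊢⇒reachesRightRule d s E)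
⊢⇒reachesRightRule (𝟏L d) s E = reachesRightRule-step 𝟏-step ⊆-refl (⊢⇒reachesRightRule d s E)
⊢⇒reachesRightRule (&L₁ d) s E = reachesRightRule-step &₁-step ⊆-refl (⊢⇒reachesRightRule d s E)
⊢⇒reachesRightRule (&L₂ d) s E = reachesRightRule-step &₂-step ⊆-refl (⊢⇒reachesRightRule d s E)
⊢⇒reachesRightRule (!L d) s E =
  reachesRightRule-step !-step (xs⊆x∷xs _ _) (⊢⇒reachesRightRule d (∷⁺ʳ _ s) E)
⊢⇒reachesRightRule init s E = reachesRightRule-now init
⊢⇒reachesRightRule (⊗R d₁ d₂) s E = reachesRightRule-now (⊗R (weaken s d₁) (weaken s d₂))
⊢⇒reachesRightRule 𝟏R s E = reachesRightRule-now 𝟏R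
⊢⇒reachesRightRule ⊤R s E = reachesRightRule-now ⊤R
⊢⇒reachesRightRule (&R d₁ d₂) s E = reachesRightRule-now (&R (weaken s d₁) (weaken s d₂))
⊢⇒reachesRightRule (⊸R d) s E = reachesRightRule-now (⊸R (weaken s d))
⊢⇒reachesRightRule (!R d) s E = reachesRightRule-now (!R (weaken s d))
-- The producer of a is run first, with the consumer a ⊸ B parked in its frame; then they synchronise.
⊢⇒reachesRightRule (⊸L {Δ₁ = Δ₁} {Δ₂} {a} {B} d₁ d₂) s E
  with ⊢⇒reachesRightRule d₁ s ((a ⊸ B) ∷ Δ₂ ++ E)
... | G₁ , _ , run₁ , G⊆G₁ , init =
  reachesRightRule-↭ producer-first
    (reachesRightRule-⇒τ run₁ G⊆G₁ (reachesRightRule-step sync-step ⊆-refl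
      (⊢⇒reachesRightRule d₂ (⊆-trans s G⊆G₁) E)))
  where
  producer-first : (a ⊸ B) ∷ (Δ₁ ++ Δ₂) ++ E ↭ Δ₁ ++ (a ⊸ B) ∷ Δ₂ ++ E
  producer-first = ↭-trans (prep _ (++-assoc Δ₁ Δ₂ E)) (↭-sym (shift _ Δ₁ (Δ₂ ++ E)))

infix 3 _⨾_⊢*_
data _⨾_⊢*_ (G : Ctx) : Ctx → Ctx → Set where
  []  : G ⨾ [] ⊢* []
  _∷_ : ∀ {D X Ds Xs} → G ⨾ D ⊢ X → G ⨾ Ds ⊢* Xs → G ⨾ D ++ Ds ⊢* X ∷ Xs

⊢*-weaken : ∀ {G G' Ds Xs} → G ⊆ G' → G ⨾ Ds ⊢* Xs → G' ⨾ Ds ⊢* Xs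
⊢*-weaken s []       = []
⊢*-weaken s (d ∷ ds) = weaken s d ∷ ⊢*-weaken s ds

⊢*-resp-↭ : ∀ {G Ds Xs Ys} → G ⨾ Ds ⊢* Xs → Xs ↭ Ys → ∃[ Ds' ] (Ds ↭ Ds' × G ⨾ Ds' ⊢* Ys)
⊢*-resp-↭ ds refl = _ , ↭-refl , ds
⊢*-resp-↭ (_∷_ {D} d ds) (prep _ p) with ⊢*-resp-↭ ds p
... | Ds' , q , ds' = D ++ Ds' , ++⁺ˡ D q , d ∷ ds'
⊢*-resp-↭ (_∷_ {D₁} d₁ (_∷_ {D₂} d₂ ds)) (swap _ _ p) with ⊢*-resp-↭ ds p
... | Ds' , q , ds' = D₂ ++ D₁ ++ Ds' , ↭-trans (++⁺ˡ D₁ (++⁺ˡ D₂ q)) (shifts D₁ D₂) , d₂ ∷ d₁ ∷ ds'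
⊢*-resp-↭ ds (trans p₁ p₂) with ⊢*-resp-↭ ds p₁
... | Ds₁ , q₁ , ds₁ with ⊢*-resp-↭ ds₁ p₂
... | Ds₂ , q₂ , ds₂ = Ds₂ , ↭-trans q₁ q₂ , ds₂

⊢*-++⁻ : ∀ {G Ds Ys} Xs → G ⨾ Ds ⊢* Xs ++ Ys →
  ∃[ Ds₁ ] ∃[ Ds₂ ] (Ds ≡ Ds₁ ++ Ds₂ × G ⨾ Ds₁ ⊢* Xs × G ⨾ Ds₂ ⊢* Ys)
⊢*-++⁻ []       ds                = [] , _ , refl , [] , ds
⊢*-++⁻ (X ∷ Xs) (_∷_ {D} d ds) with ⊢*-++⁻ Xs ds
... | Ds₁ , Ds₂ , refl , ds₁ , ds₂ = D ++ Ds₁ , Ds₂ , sym (List.++-assoc D Ds₁ Ds₂) , d ∷ ds₁ , ds₂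

ProvedBy : State → State → Set
ProvedBy (Γ₁ , Δ₁) (Γ₂ , Δ₂) = (∀ {B} → B ∈ Γ₁ → Γ₂ ⨾ [] ⊢ B) × ∃[ Ds ] (Δ₂ ↭ Ds × Γ₂ ⨾ Ds ⊢* Δ₁)

provedBy-weaken : ∀ {Γ Δ G G' E} → G ⊆ G' → ProvedBy (Γ , Δ) (G , E) → ProvedBy (Γ , Δ) (G' , E)
provedBy-weaken s (unr , Ds , p , ds) = (λ m → weaken s (unr m)) , Ds , p , ⊢*-weaken s ds

provedBy-∷ : ∀ {Γ Δ G D E X} → G ⨾ D ⊢ X → ProvedBy (Γ , Δ) (G , E) → ProvedBy (Γ , X ∷ Δ) (G , D ++ E)
provedBy-∷ {D = D} d (unr , Ds , p , ds) = unr , D ++ Ds , ++⁺ˡ D p , d ∷ ds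

provedBy-resp-≅ : ∀ {S₁ S₁' S₂ S₂'} → ProvedBy S₁ S₂ → S₁ ≅ S₁' → S₂ ≅ S₂' → ProvedBy S₁' S₂'
provedBy-resp-≅ (unr , Ds , p , ds) (Γ₁≈ , Δ₁↭) (Γ₂≈ , Δ₂↭) with ⊢*-resp-↭ ds Δ₁↭
... | Ds' , q , ds' =
  (λ m → weaken (Equivalence.to Γ₂≈) (unr (Equivalence.from Γ₁≈ m))) ,
  Ds' , ↭-trans (↭-sym Δ₂↭) (↭-trans p q) , ⊢*-weaken (Equivalence.to Γ₂≈) ds'

provedBy-≅ˡ : ∀ {S₁ S₁' S₂} → ProvedBy S₁ S₂ → S₁ ≅ S₁' → ProvedBy S₁' S₂
provedBy-≅ˡ r e = provedBy-resp-≅ r e ≅-refl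

-- F is an extra resource running alongside, such as the atom received by an input.
provedBy-runHead : ∀ {Γ Δ G E X} F → ProvedBy (Γ , X ∷ Δ) (G , E) →
  ∃[ G' ] ∃[ D ] ∃[ E' ] ((G , F ++ E) ⇒τ (G' , D ++ F ++ E') × RightRule G' D X × ProvedBy (Γ , Δ) (G' , E'))
provedBy-runHead F (unr , _ , p , _∷_ {D} {Ds = Ds} d ds)
  with ⊢⇒reachesRightRule d ⊆-refl (F ++ Ds)
... | G' , D' , run , G⊆G' , rule =
  G' , D' , Ds , ≅-⇒τ (SetEq.refl , F-beside-D) run , rule ,
  provedBy-weaken G⊆G' (unr , Ds , ↭-refl , ds)
  where
  F-beside-D : F ++ _ ↭ D ++ F ++ Ds
  F-beside-D = ↭-trans (++⁺ˡ F p) (shifts F D)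

provedBy-output : ∀ {Γ Δ S a} → ProvedBy (Γ , atom a ∷ Δ) S →
  ∃[ G ] ∃[ E ] (S ⇒τ (G , atom a ∷ E) × ProvedBy (Γ , Δ) (G , E))
provedBy-output r with provedBy-runHead [] r
... | G , _ , E , run , init , r' = G , E , run , r'

provedBy-input : ∀ {Γ Δ G E a B} → ProvedBy (Γ , (a ⊸ B) ∷ Δ) (G , E) →
  ∃[ S ] ((G , atom a ∷ E) ⇒τ S × ProvedBy (Γ , B ∷ Δ) S)
provedBy-input {a = a} r with provedBy-runHead [ atom a ] r
... | G' , D , E' , run , ⊸R d , r' =
  _ , run , provedBy-resp-≅ (provedBy-∷ d r') ≅-refl (SetEq.refl , ↭-sym (shift (atom a) D E'))

provedBy-headStep : ∀ {U U' S} → ProvedBy U S → HeadStep U U' → ∃[ S' ] (S ⇒τ S' × ProvedBy U' S')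
provedBy-headStep r ⊗-step with provedBy-runHead [] r
... | G , _ , E , run , ⊗R {D₁} {D₂} d₁ d₂ , r' =
  _ , run , provedBy-resp-≅ (provedBy-∷ d₁ (provedBy-∷ d₂ r')) ≅-refl
                            (SetEq.refl , ↭-sym (++-assoc D₁ D₂ E))
provedBy-headStep r 𝟏-step with provedBy-runHead [] r
... | _ , _ , _ , run , 𝟏R , r' = _ , run , r'
provedBy-headStep r &₁-step with provedBy-runHead [] r
... | _ , _ , _ , run , &R d₁ d₂ , r' = _ , run , provedBy-∷ d₁ r'
provedBy-headStep r &₂-step with provedBy-runHead [] r
... | _ , _ , _ , run , &R d₁ d₂ , r' = _ , run , provedBy-∷ d₂ r'
provedBy-headStep r !-step with provedBy-runHead [] r
... | _ , _ , _ , run , !R d , (unr , r') = _ , run , unr' , r'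
  where
  unr' : ∀ {B} → B ∈ _ ∷ _ → _ ⨾ [] ⊢ B
  unr' (here refl) = d
  unr' (there m)   = unr m
provedBy-headStep (unr , r) (copy-step m) = _ , ⇒τ-reflexive ≅-refl , provedBy-∷ (unr m) (unr , r)
provedBy-headStep r sync-step with provedBy-output r
... | G , E , run₁ , r₁ with provedBy-input r₁
... | S' , run₂ , r₂ = S' , ⇒τ-trans run₁ run₂ , r₂

provedBy-isSimulation : IsSimulation ProvedBy
provedBy-isSimulation = record
  { respects = provedBy-resp-≅
  ; empty    = λ r e → empty (provedBy-≅ˡ r e)
  ; split    = λ r e → split (provedBy-≅ˡ r e)
  ; stepτ    = λ { r (_ , _ , e , t , e') → stepτ r e t e' }
  ; step!    = λ { r (_ , _ , e , out , e') → step! (provedBy-≅ˡ r e) e' }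
  ; step?    = λ { r (_ , _ , e , inp , e') → step? (provedBy-≅ˡ r e) e' }
  }
  where
  empty : ∀ {Γ S} → ProvedBy (Γ , []) S → ∃[ G ] (S ⇒τ (G , []) × ProvedBy (Γ , []) (G , []))
  empty {S = G , _} (unr , _ , p , []) = G , ⇒τ-reflexive (SetEq.refl , p) , unr , [] , ↭-refl , []

  split : ∀ {P Q S} → ProvedBy (P ∥ Q) S → ∃[ P' ] ∃[ Q' ] (S ⇒τ (P' ∥ Q') × ProvedBy P P' × ProvedBy Q Q')
  split {ΓP , ΔP} {S = G , _} (unr , _ , p , ds) with ⊢*-++⁻ ΔP ds
  ... | Ds₁ , Ds₂ , refl , ds₁ , ds₂ =
    (G , Ds₁) , (G , Ds₂) ,
    ⇒τ-reflexive (SetEq.sym (++-idempotent G) , p) ,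
    ((λ m → unr (∈-++⁺ˡ m)) , Ds₁ , ↭-refl , ds₁) ,
    ((λ m → unr (∈-++⁺ʳ ΓP m)) , Ds₂ , ↭-refl , ds₂)

  stepτ : ∀ {S₁ S₂ S₁' T T'} → ProvedBy S₁ S₂ → S₁ ≅ T → T ─[ τ ]→₀ T' → T' ≅ S₁'
        → ∃[ S₂' ] (S₂ ⇒τ S₂' × ProvedBy S₁' S₂')
  stepτ r e t e' with ─[τ]→₀⇒HeadStep t
  ... | U , U' , T≅U , n , U'≅T' with provedBy-headStep (provedBy-≅ˡ r (≅-trans e T≅U)) n
  ... | S₂' , run , r' = S₂' , run , provedBy-≅ˡ r' (≅-trans U'≅T' e')

  step! : ∀ {Γ Δ S₂ S₁' a} → ProvedBy (Γ , atom a ∷ Δ) S₂ → (Γ , Δ) ≅ S₁'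
        → ∃[ S₂' ] (S₂ ⇒[ !ₗ a ] S₂' × ProvedBy S₁' S₂')
  step! r e' with provedBy-output r
  ... | G , E , run , r' =
    (G , E) , (_ , _ , run , ─[]→₀⇒─[]→ out , ⇒τ-reflexive ≅-refl) , provedBy-≅ˡ r' e'

  step? : ∀ {Γ Δ G E S₁' a B} → ProvedBy (Γ , (a ⊸ B) ∷ Δ) (G , E) → (Γ , B ∷ Δ) ≅ S₁'
        → ∃[ S₂' ] ((G , atom a ∷ E) ⇒τ S₂' × ProvedBy S₁' S₂')
  step? r e' with provedBy-input r
  ... | S₂' , run , r' = S₂' , run , provedBy-≅ˡ r' e'

corollary1 : ∀ (Γ Δ : Ctx) (A : Formula) → Γ ⨾ Δ ⊢ A → ([] , A ∷ []) ⪯ₛ (Γ , Δ)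
corollary1 Γ Δ A d =
  ProvedBy , provedBy-isSimulation , (λ ()) , Δ ++ [] , ↭-sym (++-identityʳ Δ) , d ∷ []
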